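{- For all LNF-terms $M,N$ and every variable $x$, $\mathsf{C}(M,x.N)\twoheadrightarrow_{\pi}\mathsf{C}_v(M:x.N)$ in $\lambda Q$, i.e. by zero or more steps of the rules $\pi_1,\pi_2$.
   Context: $\lambda Q$: terms $M,N::=\uparrow V\mid x(V,y.N)\mid\mathsf{C}(M,x.N)$; values $V,W::=x\mid\lambda x.M$ (in $y(V,z.N)$ and $x.N$ the variable before the dot is bound in the following term); terms up to $\alpha$-equivalence. Rules $(\pi_1)$ $\mathsf{C}(z(V,y.P),x.N)\to z(V,y.\mathsf{C}(P,x.N))$ and $(\pi_2)$ $\mathsf{C}(\mathsf{C}(M,y.P),x.N)\to\mathsf{C}(M,y.\mathsf{C}(P,x.N))$, applicable in any subterm position. LNF-terms are the $\lambda Q$-terms in which every cut has the form $\mathsf{C}(\uparrow V,x.N)$, written $\mathsf{C}_v(V,x.N)$. Derived cut on LNF-terms: $\mathsf{C}_v(\uparrow V:z.N)=\mathsf{C}_v(V,z.N)$; $\mathsf{C}_v(x(V,y.M):z.N)=x(V,y.\mathsf{C}_v(M:z.N))$; $\mathsf{C}_v(\mathsf{C}_v(V,y.M):z.N)=\mathsf{C}_v(V,y.\mathsf{C}_v(M:z.N))$. -}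

module Defs where

open import Data.Nat using (ℕ; zero; suc)
open import Data.Fin using (Fin; zero; suc)
open import Relation.Binary.Construct.Closure.ReflexiveTransitive using (Star)

-- λQ syntax, intrinsically scoped de Bruijn representation
-- (terms up to α-equivalence).  Tm n / Val n: terms / values whose
-- free variables are among n variables.
mutual
  data Tm (n : ℕ) : Set where
    up  : Val n → Tm n
    app : Fin n → Val n → Tm (suc n) → Tm n    -- x(V, y.N) ; y is index 0 in N
    cut : Tm n → Tm (suc n) → Tm n             -- C(M, x.N) ; x is index 0 in N

  data Val (n : ℕ) : Set where
    var : Fin n → Val n
    lam : Tm (suc n) → Val n

ext : ∀ {m n} → (Fin m → Fin n) → Fin (suc m) → Fin (suc n)
ext ρ zero    = zero
ext ρ (suc i) = suc (ρ i)

mutual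
  renT : ∀ {m n} → (Fin m → Fin n) → Tm m → Tm n
  renT ρ (up V)      = up (renV ρ V)
  renT ρ (app x V N) = app (ρ x) (renV ρ V) (renT (ext ρ) N)
  renT ρ (cut M N)   = cut (renT ρ M) (renT (ext ρ) N)

  renV : ∀ {m n} → (Fin m → Fin n) → Val m → Val n
  renV ρ (var x) = var (ρ x)
  renV ρ (lam M) = lam (renT (ext ρ) M)

-- x.N pushed under one new binder y (y fresh for N):
-- index 0 (x) stays 0, the other variables shift past the new index 1 (y).
wk₁ : ∀ {n} → Tm (suc n) → Tm (suc (suc n))
wk₁ = renT (ext suc)

mutual
  infix 4 _⟶_ _⟶v_
  data _⟶_ {n : ℕ} : Tm n → Tm n → Set where
    π₁ : ∀ z V P N → cut (app z V P) N ⟶ app z V (cut P (wk₁ N))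
    π₂ : ∀ M P N   → cut (cut M P) N ⟶ cut M (cut P (wk₁ N))
    ξ-up   : ∀ {V V′} → V ⟶v V′ → up V ⟶ up V′
    ξ-appV : ∀ {x V V′ N} → V ⟶v V′ → app x V N ⟶ app x V′ N
    ξ-appN : ∀ {x V N N′} → N ⟶ N′ → app x V N ⟶ app x V N′
    ξ-cutM : ∀ {M M′ N} → M ⟶ M′ → cut M N ⟶ cut M′ N
    ξ-cutN : ∀ {M N N′} → N ⟶ N′ → cut M N ⟶ cut M N′

  data _⟶v_ {n : ℕ} : Val n → Val n → Set where
    ξ-lam : ∀ {M M′} → M ⟶ M′ → lam M ⟶v lam M′

infix 4 _↠π_
_↠π_ : ∀ {n} → Tm n → Tm n → Set
_↠π_ = Star _⟶_

mutual
  data LNF {n : ℕ} : Tm n → Set where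
    up  : ∀ {V} → LNFv V → LNF (up V)
    app : ∀ {x V N} → LNFv V → LNF N → LNF (app x V N)
    cutv : ∀ {V N} → LNFv V → LNF N → LNF (cut (up V) N)

  data LNFv {n : ℕ} : Val n → Set where
    var : ∀ {x} → LNFv (var x)
    lam : ∀ {M} → LNF M → LNFv (lam M)

Cv : ∀ {n} → Val n → Tm (suc n) → Tm n
Cv V N = cut (up V) N

Cv: : ∀ {n} (M : Tm n) → LNF M → Tm (suc n) → Tm n
Cv: (up V)          (up _)       N = Cv V N
Cv: (app x V M)     (app _ lM)   N = app x V (Cv: M lM (wk₁ N))
Cv: (cut (up V) M)  (cutv _ lM)  N = Cv V (Cv: M lM (wk₁ N))

-- Along the spine of M, each x(V, y.·) node is passed by one π₁-step and each
-- C_v(V, y.·) node by one π₂-step; the cut then sits inside the node's body and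
-- the argument repeats there.
module Submission where

open import Data.Nat using (ℕ; suc)
open import Defs
open import Relation.Binary.Construct.Closure.ReflexiveTransitive using (ε; _◅_; gmap)

↠π-appN : ∀ {n} x (V : Val n) {N N′ : Tm (suc n)} → N ↠π N′ → app x V N ↠π app x V N′
↠π-appN x V = gmap (app x V) ξ-appN

↠π-cutN : ∀ {n} (M : Tm n) {N N′ : Tm (suc n)} → N ↠π N′ → cut M N ↠π cut M N′
↠π-cutN M = gmap (cut M) ξ-cutN

cut↠πCv: : ∀ {n} (M : Tm n) (lM : LNF M) (N : Tm (suc n)) → cut M N ↠π Cv: M lM N
cut↠πCv: (up V)         (up _)      N = ε
cut↠πCv: (app x V M)    (app _ lM)  N = π₁ x V M N ◅ ↠π-appN x V (cut↠πCv: M lM (wk₁ N))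
cut↠πCv: (cut (up V) M) (cutv _ lM) N = π₂ (up V) M N ◅ ↠π-cutN (up V) (cut↠πCv: M lM (wk₁ N))

lemma5 : ∀ {n : ℕ} (M : Tm n) (N : Tm (suc n)) (lM : LNF M) → LNF N → cut M N ↠π Cv: M lM N
lemma5 M N lM _ = cut↠πCv: M lM N
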